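{- If $G$ is a finite graph with $m$ edges and at least one vertex, then $v(G)\ge\dfrac{f(G)}{\omega(G)}\ge\dfrac{2m}{\omega(G)^2}$.
   Context: For a vertex $a$, $G_a$ denotes the subgraph induced on the neighbourhood of $a$; $\theta(H)$ is the minimum number of cliques partitioning the vertex set of $H$ ($0$ for the empty graph); $k(a)=\max\{\theta(G_a),2\}$ and $f(G)=\sum_{a\in V}k(a)$. $\omega(G)$ is the clique number. $v(G)$ is the minimum number of points of a linear hypergraph (finite point set, lines are subsets of size $\ge2$, two distinct points in at most one line) whose intersection graph (vertices = lines, adjacent iff distinct and intersecting) is isomorphic to $G$. -}

module Defs where

open import Data.Nat using (ℕ; zero; suc; _≤_; _<_; _⊔_)
open import Data.Bool using (Bool; true; false)
open import Data.Fin using (Fin; toℕ)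
open import Data.Fin.Subset using (Subset; _∈_; _∩_; ∣_∣)
open import Data.Nat.ListAction using (sum)
open import Data.List using (List; map; filterᵇ; length; concatMap; allFin)
open import Data.Product using (Σ; ∃; _×_; _,_)
open import Relation.Binary.PropositionalEquality using (_≡_; _≢_)
open import Relation.Nullary using (¬_)
open import Relation.Nullary.Decidable using (⌊_⌋)
open import Function.Bundles using (_⇔_)
open import Data.Nat using (_<?_)
open import Data.Bool using (_∧_)

record Graph (n : ℕ) : Set where
  field
    adj     : Fin n → Fin n → Bool
    adj-sym : ∀ u v → adj u v ≡ adj v u
    adj-irr : ∀ u → adj u u ≡ false
open Graph public

edges : ∀ {n} → Graph n → ℕ
edges {n} G = length (filterᵇ isEdge (concatMap (λ u → map (u ,_) (allFin n)) (allFin n)))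
  where
  isEdge : Fin n × Fin n → Bool
  isEdge (u , v) = ⌊ toℕ u <? toℕ v ⌋ ∧ adj G u v

-- A partition of the neighbourhood N(a) (vertex set of G_a) into t cliques:
-- a labelling of the neighbours of a by Fin t such that equally labelled
-- distinct neighbours are adjacent (each label class is a clique of G_a).
CliqueCoverNbhd : ∀ {n} → Graph n → Fin n → ℕ → Set
CliqueCoverNbhd {n} G a t =
  Σ ((u : Fin n) → adj G a u ≡ true → Fin t) λ c →
    ∀ u w (hu : adj G a u ≡ true) (hw : adj G a w ≡ true) →
      u ≢ w → c u hu ≡ c w hw → adj G u w ≡ true

-- t = θ(G_a): the minimum number of cliques partitioning N(a) (0 if N(a) is empty).
IsTheta : ∀ {n} → Graph n → Fin n → ℕ → Set
IsTheta G a t = CliqueCoverNbhd G a t × (∀ s → CliqueCoverNbhd G a s → t ≤ s)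

kval : ℕ → ℕ
kval t = t ⊔ 2

fval : ∀ {n} → (Fin n → ℕ) → ℕ
fval {n} θs = sum (map (λ a → kval (θs a)) (allFin n))

IsClique : ∀ {n} → Graph n → Subset n → Set
IsClique G S = ∀ u v → u ∈ S → v ∈ S → u ≢ v → adj G u v ≡ true

IsOmega : ∀ {n} → Graph n → ℕ → Set
IsOmega G w = (∃ λ S → IsClique G S × ∣ S ∣ ≡ w) × (∀ S → IsClique G S → ∣ S ∣ ≤ w)

-- A linear hypergraph on the point set Fin p whose lines are indexed by the
-- vertices of G (this indexing is the isomorphism with the intersection graph):
-- every line has ≥ 2 points, two distinct lines share at most one point
-- (so lines are pairwise distinct and any two points lie in at most one line),
-- and distinct vertices are adjacent iff their lines intersect.
record Representation {n : ℕ} (G : Graph n) (p : ℕ) : Set where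
  field
    line       : Fin n → Subset p
    line-size  : ∀ u → 2 ≤ ∣ line u ∣
    linear     : ∀ u v → u ≢ v → ∣ line u ∩ line v ∣ ≤ 1
    intersects : ∀ u v → u ≢ v → (adj G u v ≡ true ⇔ ∃ λ x → x ∈ line u × x ∈ line v)

-- Given a representation, label each neighbour u of a by the point where line u meets
-- line a: equally labelled neighbours share a point of line a, hence are adjacent, so
-- θ(G_a) ≤ |line a| and, as lines have at least two points, k(a) ≤ |line a|. Summing and
-- counting incidences point by point, f(G) ≤ Σ_x #(lines through x) ≤ ω p, since the
-- lines through a point pairwise meet and so form a clique. For the second inequality,
-- each of the θ(G_a) cliques covering N(a) has at most ω vertices, so deg a ≤ k(a) ω,
-- and the handshake lemma 2m = Σ_a deg a gives 2m ≤ ω f(G).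
module Submission where

open import Defs
open import Data.Nat using (ℕ; zero; suc; _+_; _*_; _≤_; _<_; _<?_; z≤n)
open import Data.Nat.Properties
  using ( +-mono-≤; +-identityʳ; *-comm; *-monoˡ-≤; ⊔-lub; m≤m⊔n; ≤-<-trans; ≤-antisym; <-asym; ≮⇒≥
        ; +-0-commutativeMonoid; +-*-semiring; module ≤-Reasoning)
open import Data.Nat.ListAction using (sum)
open import Data.Nat.ListAction.Properties using (sum-++)
open import Data.Bool using (Bool; true; false; _∧_)
open import Data.Fin using (Fin; zero; suc; toℕ; _≟_)
open import Data.Fin.Properties using (toℕ-injective; suc-injective)
open import Data.Fin.Subset using (Subset; _∈_; ∣_∣)
open import Data.Fin.Subset.Properties using (x∈p⇒∣p-x∣<∣p∣)
open import Data.Vec using ([]; _∷_; lookup; tabulate; here; there)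
open import Data.Vec.Properties using ([]=⇒lookup; lookup⇒[]=; lookup∘tabulate)
open import Data.List using (List; map; filterᵇ; length; concatMap; allFin)
open import Data.List.Properties using (map-∘; map-concatMap; map-tabulate)
import Data.List as List
open import Data.Product using (Σ; ∃; _×_; _,_; proj₁; proj₂)
open import Algebra.Properties.CommutativeMonoid.Sum +-0-commutativeMonoid
  using (sum-syntax; sum-cong-≗; ∑-comm; ∑-distrib-+)
open import Algebra.Properties.Semiring.Sum +-*-semiring using (*-distribʳ-sum)
open import Function using (_∘_; id; case_of_)
open import Function.Bundles using (Equivalence)
open import Relation.Binary.PropositionalEquality
open import Relation.Nullary using (yes; no; does; contradiction)
open import Relation.Nullary.Decidable using (⌊_⌋; dec-true)

private
  variable
    A : Set
    m n t ω : ℕ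

indicator : Bool → ℕ
indicator true  = 1
indicator false = 0

∑-mono-≤ : {f g : Fin n → ℕ} → (∀ i → f i ≤ g i) → ∑[ i < n ] f i ≤ ∑[ i < n ] g i
∑-mono-≤ {zero}  f≤g = z≤n
∑-mono-≤ {suc n} f≤g = +-mono-≤ (f≤g zero) (∑-mono-≤ (f≤g ∘ suc))

∑≤n*c : ∀ {c} {f : Fin n → ℕ} → (∀ i → f i ≤ c) → ∑[ i < n ] f i ≤ n * c
∑≤n*c {zero}  f≤c = z≤n
∑≤n*c {suc n} f≤c = +-mono-≤ (f≤c zero) (∑≤n*c (f≤c ∘ suc))

sum-tabulate : (f : Fin n → ℕ) → sum (List.tabulate f) ≡ ∑[ i < n ] f i
sum-tabulate {zero}  f = refl
sum-tabulate {suc n} f = cong (f zero +_) (sum-tabulate (f ∘ suc))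

sum-map-allFin : (f : Fin n → ℕ) → sum (map f (allFin n)) ≡ ∑[ i < n ] f i
sum-map-allFin f = trans (cong sum (map-tabulate id f)) (sum-tabulate f)

length-filterᵇ : (P : A → Bool) (xs : List A) →
                 length (filterᵇ P xs) ≡ sum (map (indicator ∘ P) xs)
length-filterᵇ P List.[] = refl
length-filterᵇ P (x List.∷ xs) with P x
... | true  = cong suc (length-filterᵇ P xs)
... | false = length-filterᵇ P xs

sum-concatMap : (f : A → List ℕ) (xs : List A) → sum (concatMap f xs) ≡ sum (map (sum ∘ f) xs)
sum-concatMap f List.[]        = refl
sum-concatMap f (x List.∷ xs) =
  trans (sum-++ (f x) (concatMap f xs)) (cong (sum (f x) +_) (sum-concatMap f xs))

length-filterᵇ-allPairs : (P : Fin n × Fin n → Bool) →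
  length (filterᵇ P (concatMap (λ u → map (u ,_) (allFin n)) (allFin n)))
    ≡ ∑[ u < n ] ∑[ v < n ] indicator (P (u , v))
length-filterᵇ-allPairs {n} P = begin
    length (filterᵇ P (concatMap row (allFin n)))  ≡⟨ length-filterᵇ P (concatMap row (allFin n)) ⟩
    sum (map count (concatMap row (allFin n)))     ≡⟨ cong sum (map-concatMap count row (allFin n)) ⟩
    sum (concatMap (map count ∘ row) (allFin n))   ≡⟨ sum-concatMap (map count ∘ row) (allFin n) ⟩
    sum (map (sum ∘ map count ∘ row) (allFin n))   ≡⟨ sum-map-allFin (sum ∘ map count ∘ row) ⟩
    ∑[ u < n ] sum (map count (row u))             ≡⟨ sum-cong-≗ rowSum ⟩
    ∑[ u < n ] ∑[ v < n ] indicator (P (u , v))    ∎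
  where
  open ≡-Reasoning
  row : Fin n → List (Fin n × Fin n)
  row u = map (u ,_) (allFin n)
  count : Fin n × Fin n → ℕ
  count = indicator ∘ P
  rowSum : ∀ u → sum (map count (row u)) ≡ ∑[ v < n ] indicator (P (u , v))
  rowSum u = trans (cong sum (sym (map-∘ (allFin n)))) (sum-map-allFin (count ∘ (u ,_)))

∣p∣≡∑indicator : (p : Subset n) → ∣ p ∣ ≡ ∑[ x < n ] indicator (lookup p x)
∣p∣≡∑indicator []          = refl
∣p∣≡∑indicator (true  ∷ p) = cong suc (∣p∣≡∑indicator p)
∣p∣≡∑indicator (false ∷ p) = ∣p∣≡∑indicator p

∣tabulate∣≡∑indicator : (f : Fin n → Bool) → ∣ tabulate f ∣ ≡ ∑[ x < n ] indicator (f x)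
∣tabulate∣≡∑indicator f =
  trans (∣p∣≡∑indicator (tabulate f)) (sum-cong-≗ (cong indicator ∘ lookup∘tabulate f))

∈-tabulate⁺ : ∀ {f : Fin n → Bool} {x} → f x ≡ true → x ∈ tabulate f
∈-tabulate⁺ {f = f} {x} fx = lookup⇒[]= x (tabulate f) (trans (lookup∘tabulate f x) fx)

∈-tabulate⁻ : ∀ {f : Fin n → Bool} {x} → x ∈ tabulate f → f x ≡ true
∈-tabulate⁻ {f = f} {x} x∈ = trans (sym (lookup∘tabulate f x)) ([]=⇒lookup x∈)

x∈p⇒∣p∣>0 : ∀ {p : Subset n} {x} → x ∈ p → 0 < ∣ p ∣
x∈p⇒∣p∣>0 x∈p = ≤-<-trans z≤n (x∈p⇒∣p-x∣<∣p∣ x∈p)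

transpose : (Fin m → Subset n) → Fin n → Subset m
transpose S x = tabulate (λ a → lookup (S a) x)

∈-transpose⁺ : ∀ {S : Fin m → Subset n} {a x} → x ∈ S a → a ∈ transpose S x
∈-transpose⁺ x∈Sa = ∈-tabulate⁺ ([]=⇒lookup x∈Sa)

∈-transpose⁻ : ∀ {S : Fin m → Subset n} {a x} → a ∈ transpose S x → x ∈ S a
∈-transpose⁻ {S = S} {a} {x} a∈ = lookup⇒[]= x (S a) (∈-tabulate⁻ a∈)

∑∣∣-transpose : (S : Fin m → Subset n) → ∑[ a < m ] ∣ S a ∣ ≡ ∑[ x < n ] ∣ transpose S x ∣
∑∣∣-transpose {m} {n} S = begin
    ∑[ a < m ] ∣ S a ∣                                ≡⟨ sum-cong-≗ (∣p∣≡∑indicator ∘ S) ⟩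
    ∑[ a < m ] ∑[ x < n ] indicator (incident x a)   ≡⟨ ∑-comm (λ a x → indicator (incident x a)) ⟩
    ∑[ x < n ] ∑[ a < m ] indicator (incident x a)   ≡⟨ sum-cong-≗ (∣tabulate∣≡∑indicator ∘ incident) ⟨
    ∑[ x < n ] ∣ transpose S x ∣                      ∎
  where
  open ≡-Reasoning
  incident : Fin n → Fin m → Bool
  incident x a = lookup (S a) x

union-bound : (p : Subset n) (C : Fin t → Subset n) → (∀ {x} → x ∈ p → ∃ λ j → x ∈ C j) →
  ∣ p ∣ ≤ ∑[ j < t ] ∣ C j ∣
union-bound {n} {t} p C covered = begin
    ∣ p ∣                               ≡⟨ ∣p∣≡∑indicator p ⟩
    ∑[ x < n ] indicator (lookup p x)   ≤⟨ ∑-mono-≤ indicator≤∣transpose∣ ⟩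
    ∑[ x < n ] ∣ transpose C x ∣        ≡⟨ ∑∣∣-transpose C ⟨
    ∑[ j < t ] ∣ C j ∣                  ∎
  where
  open ≤-Reasoning
  indicator≤∣transpose∣ : ∀ x → indicator (lookup p x) ≤ ∣ transpose C x ∣
  indicator≤∣transpose∣ x with lookup p x in px
  ... | false = z≤n
  ... | true  = x∈p⇒∣p∣>0 (∈-transpose⁺ {S = C} (proj₂ (covered (lookup⇒[]= x p px))))

rank : (p : Subset n) {x : Fin n} → x ∈ p → Fin ∣ p ∣
rank (true  ∷ p) here        = zero
rank (true  ∷ p) (there x∈p) = suc (rank p x∈p)
rank (false ∷ p) (there x∈p) = rank p x∈p

rank-injective : (p : Subset n) {x y : Fin n} (x∈p : x ∈ p) (y∈p : y ∈ p) →
                 rank p x∈p ≡ rank p y∈p → x ≡ y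
rank-injective (true  ∷ p) here        here        _  = refl
rank-injective (true  ∷ p) (there x∈p) (there y∈p) eq =
  cong suc (rank-injective p x∈p y∈p (suc-injective eq))
rank-injective (false ∷ p) (there x∈p) (there y∈p) eq = cong suc (rank-injective p x∈p y∈p eq)

indicator-<-trichotomy : ∀ {i j} b → (b ≡ true → i ≢ j) →
  indicator (⌊ i <? j ⌋ ∧ b) + indicator (⌊ j <? i ⌋ ∧ b) ≡ indicator b
indicator-<-trichotomy {i} {j} b i≢j with i <? j | j <? i
... | yes i<j | yes j<i = contradiction j<i (<-asym i<j)
... | yes _   | no _    = +-identityʳ (indicator b)
... | no _    | yes _   = refl
indicator-<-trichotomy false _   | no _   | no _   = refl
indicator-<-trichotomy true  i≢j | no i≮j | no j≮i =
  contradiction (≤-antisym (≮⇒≥ j≮i) (≮⇒≥ i≮j)) (i≢j refl)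

module _ (G : Graph n) where

  neighbourhood : Fin n → Subset n
  neighbourhood a = tabulate (adj G a)

  adj⇒≢ : ∀ {u v} → adj G u v ≡ true → u ≢ v
  adj⇒≢ {u} uv refl = case trans (sym uv) (adj-irr G u) of λ ()

  orderedEdge : Fin n → Fin n → ℕ
  orderedEdge u v = indicator (⌊ toℕ u <? toℕ v ⌋ ∧ adj G u v)

  orderedEdge-pair : ∀ u v → orderedEdge u v + orderedEdge v u ≡ indicator (adj G u v)
  orderedEdge-pair u v rewrite adj-sym G v u =
    indicator-<-trichotomy (adj G u v) (λ uv → adj⇒≢ uv ∘ toℕ-injective)

  edges≡∑orderedEdge : edges G ≡ ∑[ u < n ] ∑[ v < n ] orderedEdge u v
  edges≡∑orderedEdge = length-filterᵇ-allPairs (λ (u , v) → ⌊ toℕ u <? toℕ v ⌋ ∧ adj G u v)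

  handshake : 2 * edges G ≡ ∑[ u < n ] ∣ neighbourhood u ∣
  handshake = begin
      2 * edges G
    ≡⟨ cong (2 *_) edges≡∑orderedEdge ⟩
      2 * E
    ≡⟨ cong (E +_) (+-identityʳ E) ⟩
      E + E
    ≡⟨ cong (E +_) (∑-comm orderedEdge) ⟩
      E + ∑[ u < n ] ∑[ v < n ] orderedEdge v u
    ≡⟨ ∑-distrib-+ (λ u → ∑[ v < n ] orderedEdge u v) _ ⟨
      ∑[ u < n ] (∑[ v < n ] orderedEdge u v + ∑[ v < n ] orderedEdge v u)
    ≡⟨ sum-cong-≗ (λ u → ∑-distrib-+ (orderedEdge u) _) ⟨
      ∑[ u < n ] ∑[ v < n ] (orderedEdge u v + orderedEdge v u)
    ≡⟨ sum-cong-≗ (sum-cong-≗ ∘ orderedEdge-pair) ⟩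
      ∑[ u < n ] ∑[ v < n ] indicator (adj G u v)
    ≡⟨ sum-cong-≗ (∣tabulate∣≡∑indicator ∘ adj G) ⟨
      ∑[ u < n ] ∣ neighbourhood u ∣
    ∎
    where
    open ≡-Reasoning
    E : ℕ
    E = ∑[ u < n ] ∑[ v < n ] orderedEdge u v

  ∣neighbourhood∣≤t*ω : ∀ {a} → CliqueCoverNbhd G a t → (∀ S → IsClique G S → ∣ S ∣ ≤ ω) →
                        ∣ neighbourhood a ∣ ≤ t * ω
  ∣neighbourhood∣≤t*ω {t} {ω} {a} (label , sameLabel⇒adj) ω-max = begin
      ∣ neighbourhood a ∣      ≤⟨ union-bound (neighbourhood a) class neighbour-classified ⟩
      ∑[ j < t ] ∣ class j ∣   ≤⟨ ∑≤n*c (λ j → ω-max (class j) (class-isClique j)) ⟩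
      t * ω                    ∎
    where
    open ≤-Reasoning
    -- The value b of adj G a v is passed together with its equation, so that the
    -- label (which needs a proof of adjacency) can be applied in the true case.
    inClass : Fin t → (v : Fin n) (b : Bool) → adj G a v ≡ b → Bool
    inClass j v true  av = does (label v av ≟ j)
    inClass j v false _  = false

    class : Fin t → Subset n
    class j = tabulate (λ v → inClass j v (adj G a v) refl)

    inClass-sound : ∀ {j v b} (e : adj G a v ≡ b) → inClass j v b e ≡ true →
                    Σ (adj G a v ≡ true) λ av → label v av ≡ j
    inClass-sound {j} {v} {true} av _ with label v av ≟ j
    ... | yes lv≡j = av , lv≡j
    inClass-sound {j} {v} {true} av () | no _

    inClass-complete : ∀ {v b} (e : adj G a v ≡ b) → b ≡ true →
                       ∃ λ j → inClass j v b e ≡ true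
    inClass-complete {v} av refl = label v av , dec-true (label v av ≟ label v av) refl

    class-isClique : ∀ j → IsClique G (class j)
    class-isClique j u w u∈ w∈ u≢w
      with au , lu≡j ← inClass-sound refl (∈-tabulate⁻ u∈)
         | aw , lw≡j ← inClass-sound refl (∈-tabulate⁻ w∈)
      = sameLabel⇒adj u w au aw u≢w (trans lu≡j (sym lw≡j))

    neighbour-classified : ∀ {v} → v ∈ neighbourhood a → ∃ λ j → v ∈ class j
    neighbour-classified v∈
      with j , v∈j ← inClass-complete refl (∈-tabulate⁻ v∈)
      = j , ∈-tabulate⁺ v∈j

module _ {G : Graph n} {p : ℕ} (R : Representation G p) where
  open Representation R

  commonPoint : ∀ {u v} → adj G u v ≡ true → ∃ λ x → x ∈ line u × x ∈ line v
  commonPoint uv = Equivalence.to (intersects _ _ (adj⇒≢ G uv)) uv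

  lineCover : ∀ a → CliqueCoverNbhd G a ∣ line a ∣
  lineCover a = label , sameLabel⇒adj
    where
    label : ∀ u → adj G a u ≡ true → Fin ∣ line a ∣
    label u au = rank (line a) (proj₁ (proj₂ (commonPoint au)))

    sameLabel⇒adj : ∀ u w au aw → u ≢ w → label u au ≡ label w aw → adj G u w ≡ true
    sameLabel⇒adj u w au aw u≢w same
      with x , _ , x∈u ← commonPoint au | y , _ , y∈w ← commonPoint aw
      with refl ← rank-injective (line a) _ _ same
      = Equivalence.from (intersects u w u≢w) (x , x∈u , y∈w)

  kval≤∣line∣ : ∀ {a t} → IsTheta G a t → kval t ≤ ∣ line a ∣
  kval≤∣line∣ {a} (_ , minimal) = ⊔-lub (minimal _ (lineCover a)) (line-size a)

  star-isClique : ∀ x → IsClique G (transpose line x)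
  star-isClique x u v u∈ v∈ u≢v =
    Equivalence.from (intersects u v u≢v)
      (x , ∈-transpose⁻ {S = line} u∈ , ∈-transpose⁻ {S = line} v∈)

  ∑∣line∣≤p*ω : ∀ {ω} → (∀ S → IsClique G S → ∣ S ∣ ≤ ω) → ∑[ a < n ] ∣ line a ∣ ≤ p * ω
  ∑∣line∣≤p*ω {ω} ω-max = begin
      ∑[ a < n ] ∣ line a ∣             ≡⟨ ∑∣∣-transpose line ⟩
      ∑[ x < p ] ∣ transpose line x ∣   ≤⟨ ∑≤n*c (λ x → ω-max (transpose line x) (star-isClique x)) ⟩
      p * ω                             ∎
    where open ≤-Reasoning

mainTheorem18 : ∀ {n : ℕ} (G : Graph (suc n)) (θs : Fin (suc n) → ℕ) (ω : ℕ) →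
    (∀ a → IsTheta G a (θs a)) → IsOmega G ω →
    (∀ p → Representation G p → fval θs ≤ ω * p) × (2 * edges G ≤ ω * fval θs)
mainTheorem18 {n} G θs ω θ-spec (_ , ω-max) = vertex-bound , edge-bound
  where
  open ≤-Reasoning

  vertex-bound : ∀ p → Representation G p → fval θs ≤ ω * p
  vertex-bound p R = begin
      fval θs                                      ≡⟨ sum-map-allFin (kval ∘ θs) ⟩
      ∑[ a < suc n ] kval (θs a)                   ≤⟨ ∑-mono-≤ (kval≤∣line∣ R ∘ θ-spec) ⟩
      ∑[ a < suc n ] ∣ Representation.line R a ∣   ≤⟨ ∑∣line∣≤p*ω R ω-max ⟩
      p * ω                                        ≡⟨ *-comm p ω ⟩
      ω * p                                        ∎

  edge-bound : 2 * edges G ≤ ω * fval θs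
  edge-bound = begin
      2 * edges G
    ≡⟨ handshake G ⟩
      ∑[ a < suc n ] ∣ neighbourhood G a ∣
    ≤⟨ ∑-mono-≤ (λ a → ∣neighbourhood∣≤t*ω G (proj₁ (θ-spec a)) ω-max) ⟩
      ∑[ a < suc n ] (θs a * ω)
    ≤⟨ ∑-mono-≤ (λ a → *-monoˡ-≤ ω (m≤m⊔n (θs a) 2)) ⟩
      ∑[ a < suc n ] (kval (θs a) * ω)
    ≡⟨ *-distribʳ-sum ω (kval ∘ θs) ⟨
      (∑[ a < suc n ] kval (θs a)) * ω
    ≡⟨ cong (_* ω) (sum-map-allFin (kval ∘ θs)) ⟨
      fval θs * ω
    ≡⟨ *-comm (fval θs) ω ⟩
      ω * fval θs
    ∎
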